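{- For $n\ge1$, let $P_n(\alpha)=\alpha\prod_{k=1}^{n-1}((n+1)\alpha+k)$. Then, for each $k$, the coefficient of $\alpha^k$ in $P_n(\alpha)$ equals the number of pairs $(\mathbf{a},\sigma)$ such that: - $\mathbf{a}$ is a parking function of length $n$; - $\sigma\in\mathfrak{S}_n$ has exactly $k$ cycles; - $\mathbf{a}\sigma=\mathbf{a}$, i.e. $a_{\sigma(i)}=a_i$ for all $i$.
   Context: A parking function of length $n$ is a word $\mathbf{a}=a_1\cdots a_n$ of positive integers whose nondecreasing rearrangement $\pi$ satisfies $\pi_i\le i$ for all $i$. -}

module Defs where

open import Data.Nat using (ℕ; zero; suc; _+_; _*_; _≤_; _<_)
open import Data.Nat.Properties using (≤-decTotalOrder)
open import Data.Fin using (Fin; toℕ)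
open import Data.Unit using (⊤)
open import Data.Vec using (Vec; lookup; toList)
open import Data.List using (List; []; _∷_; length)
open import Data.Product using (_×_; Σ; _,_)
open import Relation.Binary.PropositionalEquality using (_≡_)
import Data.List.Sort as Sort
open Sort ≤-decTotalOrder using (sort)

-- Polynomials with ℕ coefficients, as coefficient lists
-- (constant term first).

Poly : Set
Poly = List ℕ

_⊕_ : Poly → Poly → Poly
[] ⊕ q = q
(x ∷ p) ⊕ [] = x ∷ p
(x ∷ p) ⊕ (y ∷ q) = (x + y) ∷ (p ⊕ q)

scale : ℕ → Poly → Poly
scale c [] = []
scale c (x ∷ p) = c * x ∷ scale c p

_⊗_ : Poly → Poly → Poly
[] ⊗ q = []
(x ∷ p) ⊗ q = scale x q ⊕ (0 ∷ (p ⊗ q))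

coeff : ℕ → Poly → ℕ
coeff k [] = 0
coeff zero (x ∷ p) = x
coeff (suc k) (x ∷ p) = coeff k p

X : Poly
X = 0 ∷ 1 ∷ []

prodFactors : ℕ → ℕ → Poly
prodFactors n zero = 1 ∷ []
prodFactors n (suc m) = prodFactors n m ⊗ (suc m ∷ suc n ∷ [])

P : ℕ → Poly
P zero = X            -- not used (n ≥ 1 in the theorem)
P (suc m) = X ⊗ prodFactors (suc m) m

-- π_i ≤ i for all i (1-based indexing), for a list π = π_1 ⋯ π_m
BoundedFrom : ℕ → List ℕ → Set
BoundedFrom i [] = ⊤
BoundedFrom i (x ∷ xs) = (x ≤ i) × BoundedFrom (suc i) xs

IsParkingFunction : (n : ℕ) → Vec ℕ n → Set
IsParkingFunction n a =
  (∀ (i : Fin n) → 1 ≤ lookup a i) × BoundedFrom 1 (sort (toList a))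

-- Permutations of Fin n, as the vector (σ(0), …, σ(n-1))

IsPermutation : (n : ℕ) → Vec (Fin n) n → Set
IsPermutation n σ = ∀ (i j : Fin n) → lookup σ i ≡ lookup σ j → i ≡ j

iter : {n : ℕ} → Vec (Fin n) n → ℕ → Fin n → Fin n
iter σ zero i = i
iter σ (suc m) i = lookup σ (iter σ m i)

IsCycleMin : {n : ℕ} → Vec (Fin n) n → Fin n → Set
IsCycleMin σ i = ∀ (m : ℕ) → toℕ i ≤ toℕ (iter σ m i)

-- a permutation has exactly k cycles: there are exactly k cycle
-- minima, witnessed by a duplicate-free list containing exactly them
open import Data.List.Relation.Unary.Unique.Propositional using (Unique)
open import Data.List.Membership.Propositional using (_∈_)
open import Function.Bundles using (_⇔_)

HasCycles : (n : ℕ) → Vec (Fin n) n → ℕ → Set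
HasCycles n σ k =
  Σ (List (Fin n)) λ L →
    Unique L × (∀ i → (i ∈ L) ⇔ IsCycleMin σ i) × (length L ≡ k)

Fixes : (n : ℕ) → Vec ℕ n → Vec (Fin n) n → Set
Fixes n a σ = ∀ (i : Fin n) → lookup a (lookup σ i) ≡ lookup a i

Counted : (n k : ℕ) → Vec ℕ n × Vec (Fin n) n → Set
Counted n k (a , σ) =
  IsParkingFunction n a × IsPermutation n σ × HasCycles n σ k × Fixes n a σ

module Submission where

-- Pollak's cyclic argument, refined by the number of cycles.  Put N = n + 1.
-- (1) Call (σ , a) an invariant pair of size m when σ permutes Fin m and the
--     word a over Fin N satisfies a ∘ σ = a.  Such a pair of size m + 1 arises
--     uniquely from one of size m by adding m as a new fixed point (a new cycle,
--     N choices of letter) or right after some j in its cycle (m choices, letter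
--     a_j forced); so those with k cycles number coeff k of ∏_{i<m} (i + Nα).
-- (2) Of the N cyclic rotations of the letters of a word of length n exactly one
--     is a parking function: with A t = #{letters < t}, the rotation sending s
--     to 0 parks iff s + 1 is the first minimum of t ↦ A t − t on [1, N].
--     Rotations preserve invariance, so parking invariant pairs are 1/N of all.
-- (3) For n ≥ 1, ∏_{i<n} (i + Nα) = N · P n, which gives the theorem.

open import Defs
open import Data.Nat using (ℕ; zero; suc; _+_; _*_; _∸_; _≤_; _<_; _≤?_; _<?_; z≤n; s≤s)
open import Data.Nat.Properties hiding (_≟_)
open import Data.Nat.DivMod using (_%_; m%n<n; m%n%n≡m%n; %-distribˡ-+; [m+n]%n≡m%n; m<n⇒m%n≡m)
open import Data.Nat.Tactic.RingSolver using (solve-∀)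
open import Data.Fin using (Fin; zero; suc; toℕ; fromℕ; fromℕ<; inject₁; lower₁; _≟_)
open import Data.Fin.Properties
  using (toℕ-injective; toℕ<n; toℕ-fromℕ; toℕ-fromℕ<; toℕ-inject₁; inject₁-injective; fromℕ≢inject₁; inject₁-lower₁
        ; any?; all?; injective⇒≤)
open import Data.Vec using (Vec; []; _∷_; lookup; tabulate; toList; _∷ʳ_; initLast)
import Data.Vec as Vec
import Data.Vec.Relation.Unary.All.Properties as VecAll
open import Data.Vec.Properties using (lookup∘tabulate; tabulate∘lookup; tabulate-cong; lookup-map; length-toList; ∷ʳ-injective)
open import Data.List using (List; []; _∷_; length; map; _++_; filter; cartesianProduct; allFin)
open import Data.List.Properties using (length-map; length-++; length-tabulate; length-filter; filter-none; filter-accept)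
open import Data.List.Membership.Propositional using (_∈_)
open import Data.List.Membership.Propositional.Properties
  using (∈-map⁺; ∈-map⁻; ∈-++⁺ˡ; ∈-++⁺ʳ; ∈-++⁻; ∈-filter⁺; ∈-filter⁻
        ; ∈-cartesianProduct⁺; ∈-cartesianProduct⁻; ∈-allFin)
open import Data.List.Membership.Propositional.Properties.WithK using (unique∧set⇒bag)
open import Data.List.Relation.Binary.BagAndSetEquality using (∼bag⇒↭)
open import Data.List.Relation.Binary.Permutation.Propositional using (_↭_)
open import Data.List.Relation.Binary.Permutation.Propositional.Properties using (↭-length; filter-↭)
open import Data.List.Relation.Unary.Any using (here; there)
import Data.List.Relation.Unary.Any as Any
open import Data.List.Relation.Unary.All using (All; []; _∷_)
import Data.List.Relation.Unary.All as All
import Data.List.Relation.Unary.All.Properties as All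
open import Data.List.Relation.Unary.Linked using (Linked)
import Data.List.Relation.Unary.Linked as Linked
open import Data.List.Relation.Unary.Linked.Properties using (Linked⇒All)
open import Data.List.Relation.Unary.Unique.Propositional using (Unique; []; _∷_)
open import Data.List.Relation.Unary.Unique.Propositional.Properties
  using (map⁺; ++⁺; filter⁺; cartesianProduct⁺; allFin⁺)
open import Data.Product using (Σ; ∃; _×_; _,_; proj₁; proj₂)
open import Function using (_∘_)
open import Data.Sum using (_⊎_; inj₁; inj₂; [_,_]′)
open import Data.Sum.Properties using (inj₁-injective; inj₂-injective)
open import Data.Unit using (tt)
open import Data.Empty using (⊥; ⊥-elim)
open import Function.Bundles using (_⇔_; mk⇔; Equivalence)
open import Relation.Nullary using (¬_; Dec; yes; no)
open import Relation.Nullary.Decidable using (_×-dec_)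
open import Relation.Binary.Definitions using (tri<; tri≈; tri>)
open import Relation.Unary using (Decidable; ∁)
open import Relation.Unary.Properties using (_∩?_; ∁?)
import Data.List.Sort as Sort
open Sort ≤-decTotalOrder using (sort; sort-↭; sort-↗)
open import Relation.Binary.PropositionalEquality
  using (_≡_; _≢_; refl; sym; trans; cong; cong₂; subst; subst₂; module ≡-Reasoning)

open Equivalence using (to; from)

Enumeration : {A : Set} → (A → Set) → Set
Enumeration {A} P = Σ (List A) λ L → Unique L × (∀ x → (x ∈ L) ⇔ P x)

card : {A : Set} {P : A → Set} → Enumeration P → ℕ
card e = length (proj₁ e)

-- The number of elements does not depend on the enumeration: two
-- duplicate-free lists with the same members are permutations of each other.
card-cong : {A : Set} {P Q : A → Set} (e₁ : Enumeration P) (e₂ : Enumeration Q) →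
            (∀ x → P x ⇔ Q x) → card e₁ ≡ card e₂
card-cong (L₁ , u₁ , m₁) (L₂ , u₂ , m₂) P⇔Q = ↭-length (∼bag⇒↭ (unique∧set⇒bag u₁ u₂ same))
  where
  same : ∀ {x} → (x ∈ L₁) ⇔ (x ∈ L₂)
  same {x} = mk⇔ (λ x∈ → from (m₂ x) (to (P⇔Q x) (to (m₁ x) x∈)))
                 (λ x∈ → from (m₁ x) (from (P⇔Q x) (to (m₂ x) x∈)))

enumerate-image : {A B : Set} {P : A → Set} {Q : B → Set} (f : A → B) →
  (∀ {x y} → P x → P y → f x ≡ f y → x ≡ y) →
  (∀ x → P x → Q (f x)) → (∀ y → Q y → ∃ λ x → P x × f x ≡ y) →
  (e : Enumeration P) → Σ (Enumeration Q) λ e′ → card e′ ≡ card e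
enumerate-image {P = P} {Q = Q} f inj pres onto (L , u , m) =
  (map f L , unique-image u (λ {x} x∈ → to (m x) x∈) , member) , length-map f L
  where
  unique-image : ∀ {xs} → Unique xs → (∀ {x} → x ∈ xs → P x) → Unique (map f xs)
  unique-image [] _ = []
  unique-image (x∉xs ∷ u′) px =
    All.map⁺ (All.tabulate λ y∈ fx≡fy → All.lookup x∉xs y∈ (inj (px (here refl)) (px (there y∈)) fx≡fy))
    ∷ unique-image u′ (λ x∈ → px (there x∈))
  member : ∀ y → (y ∈ map f L) ⇔ Q y
  member y = mk⇔ (λ y∈ → let (x , x∈ , y≡) = ∈-map⁻ f y∈ in subst Q (sym y≡) (pres x (to (m x) x∈)))
                 (λ qy → let (x , px , fx≡y) = onto y qy in subst (_∈ map f L) fx≡y (∈-map⁺ f (from (m x) px)))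

enumerate-⊎ : {A B : Set} {P : A → Set} {Q : B → Set} (e₁ : Enumeration P) (e₂ : Enumeration Q) →
  Σ (Enumeration [ P , Q ]′) λ e → card e ≡ card e₁ + card e₂
enumerate-⊎ {P = P} {Q = Q} (L₁ , u₁ , m₁) (L₂ , u₂ , m₂) =
  (map inj₁ L₁ ++ map inj₂ L₂ , unique , member) ,
  trans (length-++ (map inj₁ L₁)) (cong₂ _+_ (length-map inj₁ L₁) (length-map inj₂ L₂))
  where
  unique : Unique (map inj₁ L₁ ++ map inj₂ L₂)
  unique = ++⁺ (map⁺ inj₁-injective u₁) (map⁺ inj₂-injective u₂) disjoint
    where
    disjoint : ∀ {v} → v ∈ map inj₁ L₁ × v ∈ map inj₂ L₂ → ⊥
    disjoint (v∈₁ , v∈₂) with ∈-map⁻ inj₁ v∈₁ | ∈-map⁻ inj₂ v∈₂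
    ... | _ , _ , refl | _ , _ , ()
  member : ∀ v → (v ∈ map inj₁ L₁ ++ map inj₂ L₂) ⇔ [ P , Q ]′ v
  member (inj₁ x) = mk⇔ (λ v∈ → to (m₁ x) (left (∈-++⁻ (map inj₁ L₁) v∈)))
                        (λ px → ∈-++⁺ˡ (∈-map⁺ inj₁ (from (m₁ x) px)))
    where
    left : inj₁ x ∈ map inj₁ L₁ ⊎ inj₁ x ∈ map inj₂ L₂ → x ∈ L₁
    left (inj₁ v∈) with ∈-map⁻ inj₁ v∈
    ... | _ , x∈ , refl = x∈
    left (inj₂ v∈) with ∈-map⁻ inj₂ v∈
    ... | _ , _ , ()
  member (inj₂ y) = mk⇔ (λ v∈ → to (m₂ y) (right (∈-++⁻ (map inj₁ L₁) v∈)))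
                        (λ qy → ∈-++⁺ʳ (map inj₁ L₁) (∈-map⁺ inj₂ (from (m₂ y) qy)))
    where
    right : inj₂ y ∈ map inj₁ L₁ ⊎ inj₂ y ∈ map inj₂ L₂ → y ∈ L₂
    right (inj₁ v∈) with ∈-map⁻ inj₁ v∈
    ... | _ , _ , ()
    right (inj₂ v∈) with ∈-map⁻ inj₂ v∈
    ... | _ , y∈ , refl = y∈

length-cartesianProduct : {A B : Set} (xs : List A) (ys : List B) →
                          length (cartesianProduct xs ys) ≡ length xs * length ys
length-cartesianProduct [] ys = refl
length-cartesianProduct (x ∷ xs) ys = begin
  length (map (x ,_) ys ++ cartesianProduct xs ys)       ≡⟨ length-++ (map (x ,_) ys) ⟩
  length (map (x ,_) ys) + length (cartesianProduct xs ys) ≡⟨ cong₂ _+_ (length-map (x ,_) ys) (length-cartesianProduct xs ys) ⟩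
  length ys + length xs * length ys                      ∎
  where open ≡-Reasoning

enumerate-Fin× : {B : Set} {Q : B → Set} (p : ℕ) (e : Enumeration Q) →
  Σ (Enumeration (λ (x : Fin p × B) → Q (proj₂ x))) λ e′ → card e′ ≡ p * card e
enumerate-Fin× p (L , u , m) =
  (cartesianProduct (allFin p) L , cartesianProduct⁺ (allFin⁺ p) u ,
   λ (i , y) → mk⇔ (λ iy∈ → to (m y) (proj₂ (∈-cartesianProduct⁻ (allFin p) L iy∈)))
                   (λ qy → ∈-cartesianProduct⁺ (∈-allFin i) (from (m y) qy))) ,
  trans (length-cartesianProduct (allFin p) L) (cong (_* length L) (length-tabulate {n = p} (λ i → i)))

enumerate-filter : {A : Set} {P Q : A → Set} → Enumeration P → Decidable Q → Enumeration (λ x → P x × Q x)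
enumerate-filter (L , u , m) Q? =
  filter Q? L , filter⁺ Q? u ,
  λ x → mk⇔ (λ x∈ → let (x∈L , qx) = ∈-filter⁻ Q? x∈ in to (m x) x∈L , qx)
            (λ (px , qx) → ∈-filter⁺ Q? (from (m x) px) qx)

enumerate-∅ : {A : Set} {P : A → Set} → (∀ x → ¬ P x) → Σ (Enumeration P) λ e → card e ≡ 0
enumerate-∅ ¬P = ([] , [] , λ x → mk⇔ (λ ()) (λ px → ⊥-elim (¬P x px))) , refl

coeff-⊕ : ∀ k p q → coeff k (p ⊕ q) ≡ coeff k p + coeff k q
coeff-⊕ k [] q = refl
coeff-⊕ zero (x ∷ p) [] = sym (+-identityʳ x)
coeff-⊕ (suc k) (x ∷ p) [] = sym (+-identityʳ (coeff k p))
coeff-⊕ zero (x ∷ p) (y ∷ q) = refl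
coeff-⊕ (suc k) (x ∷ p) (y ∷ q) = coeff-⊕ k p q

coeff-scale : ∀ k c p → coeff k (scale c p) ≡ c * coeff k p
coeff-scale k c [] = sym (*-zeroʳ c)
coeff-scale zero c (x ∷ p) = refl
coeff-scale (suc k) c (x ∷ p) = coeff-scale k c p

-- The coefficient of α^(k-1) (zero for k = 0), i.e. the coefficient of α^k in α·p.
coeffBelow : ℕ → Poly → ℕ
coeffBelow zero p = 0
coeffBelow (suc k) p = coeff k p

coeffBelow-[] : ∀ k → coeffBelow k [] ≡ 0
coeffBelow-[] zero = refl
coeffBelow-[] (suc k) = refl

coeff-0∷ : ∀ k p → coeff k (0 ∷ p) ≡ coeffBelow k p
coeff-0∷ zero p = refl
coeff-0∷ (suc k) p = refl

coeff-∷⊗ : ∀ k x p q → coeff k ((x ∷ p) ⊗ q) ≡ x * coeff k q + coeffBelow k (p ⊗ q)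
coeff-∷⊗ k x p q = begin
  coeff k (scale x q ⊕ (0 ∷ (p ⊗ q)))          ≡⟨ coeff-⊕ k (scale x q) (0 ∷ (p ⊗ q)) ⟩
  coeff k (scale x q) + coeff k (0 ∷ (p ⊗ q))  ≡⟨ cong₂ _+_ (coeff-scale k x q) (coeff-0∷ k (p ⊗ q)) ⟩
  x * coeff k q + coeffBelow k (p ⊗ q)         ∎
  where open ≡-Reasoning

coeff-⊗-linear : ∀ k p a b → coeff k (p ⊗ (a ∷ b ∷ [])) ≡ a * coeff k p + b * coeffBelow k p
coeff-⊗-linear k [] a b = sym (cong₂ _+_ (*-zeroʳ a) (trans (cong (b *_) (coeffBelow-[] k)) (*-zeroʳ b)))
coeff-⊗-linear zero (x ∷ p) a b = trans (coeff-∷⊗ 0 x p (a ∷ b ∷ [])) (rearrange x a b)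
  where
  rearrange : ∀ x a b → x * a + 0 ≡ a * x + b * 0
  rearrange = solve-∀
coeff-⊗-linear (suc zero) (x ∷ p) a b =
  trans (coeff-∷⊗ 1 x p (a ∷ b ∷ [])) (trans (cong (x * b +_) (coeff-⊗-linear 0 p a b)) (rearrange x a b (coeff 0 p)))
  where
  rearrange : ∀ x a b c → x * b + (a * c + b * 0) ≡ a * c + b * x
  rearrange = solve-∀
coeff-⊗-linear (suc (suc k)) (x ∷ p) a b =
  trans (coeff-∷⊗ (suc (suc k)) x p (a ∷ b ∷ [])) (cong₂ _+_ (*-zeroʳ x) (coeff-⊗-linear (suc k) p a b))

coeff-X⊗ : ∀ k q → coeff k (X ⊗ q) ≡ coeffBelow k q
coeff-X⊗ zero q = coeff-∷⊗ 0 0 (1 ∷ []) q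
coeff-X⊗ (suc k) q = begin
  coeff (suc k) (X ⊗ q)                         ≡⟨ coeff-∷⊗ (suc k) 0 (1 ∷ []) q ⟩
  coeff k ((1 ∷ []) ⊗ q)                        ≡⟨ coeff-∷⊗ k 1 [] q ⟩
  1 * coeff k q + coeffBelow k []               ≡⟨ cong₂ _+_ (*-identityˡ (coeff k q)) (coeffBelow-[] k) ⟩
  coeff k q + 0                                 ≡⟨ +-identityʳ (coeff k q) ⟩
  coeff k q                                     ∎
  where open ≡-Reasoning

-- Rising N m = ∏_{i<m} (i + Nα): the generating polynomial, by number of cycles,
-- of the invariant pairs of size m (count-invariant below).
Rising : ℕ → ℕ → Poly
Rising N zero = 1 ∷ []
Rising N (suc m) = Rising N m ⊗ (m ∷ N ∷ [])

coeff-Rising : ∀ n m k → coeff k (Rising (suc n) (suc m)) ≡ suc n * coeffBelow k (prodFactors n m)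
coeff-Rising n zero k = coeff-⊗-linear k (1 ∷ []) 0 (suc n)
coeff-Rising n (suc m) zero = begin
  coeff 0 (R ⊗ (suc m ∷ N ∷ []))        ≡⟨ coeff-⊗-linear 0 R (suc m) N ⟩
  suc m * coeff 0 R + N * 0             ≡⟨ cong₂ _+_ (cong (suc m *_) (coeff-Rising n m 0)) (*-zeroʳ N) ⟩
  suc m * (N * 0) + 0                   ≡⟨ cong (λ z → suc m * z + 0) (*-zeroʳ N) ⟩
  suc m * 0 + 0                         ≡⟨ cong (_+ 0) (*-zeroʳ (suc m)) ⟩
  0                                     ≡⟨ sym (*-zeroʳ N) ⟩
  N * 0                                 ∎
  where
  open ≡-Reasoning
  N = suc n
  R = Rising N (suc m)
coeff-Rising n (suc m) (suc k) = begin
  coeff (suc k) (R ⊗ (suc m ∷ N ∷ []))                   ≡⟨ coeff-⊗-linear (suc k) R (suc m) N ⟩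
  suc m * coeff (suc k) R + N * coeff k R                ≡⟨ cong₂ (λ u v → suc m * u + N * v)
                                                              (coeff-Rising n m (suc k)) (coeff-Rising n m k) ⟩
  suc m * (N * c) + N * (N * d)                          ≡⟨ rearrange (suc m) N c d ⟩
  N * (suc m * c + N * d)                                ≡⟨ cong (N *_) (sym (coeff-⊗-linear k Π (suc m) N)) ⟩
  N * coeff k (Π ⊗ (suc m ∷ N ∷ []))                     ∎
  where
  open ≡-Reasoning
  N = suc n
  R = Rising N (suc m)
  Π = prodFactors n m
  c = coeff k Π
  d = coeffBelow k Π
  rearrange : ∀ a N c d → a * (N * c) + N * (N * d) ≡ N * (a * c + N * d)
  rearrange = solve-∀

coeff-Rising-P : ∀ n → 1 ≤ n → ∀ k → coeff k (Rising (suc n) n) ≡ suc n * coeff k (P n)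
coeff-Rising-P (suc n′) _ k =
  trans (coeff-Rising (suc n′) n′ k) (cong (suc (suc n′) *_) (sym (coeff-X⊗ k (prodFactors (suc n′) n′))))

data LastView {m : ℕ} : Fin (suc m) → Set where
  last : LastView (fromℕ m)
  inj  : (i : Fin m) → LastView (inject₁ i)

lastView : ∀ {m} (x : Fin (suc m)) → LastView x
lastView {zero} zero = last
lastView {suc m} zero = inj zero
lastView {suc m} (suc x) with lastView x
... | last = last
... | inj i = inj (suc i)

lowerLast : ∀ {m} (x : Fin (suc m)) → x ≢ fromℕ m → Fin m
lowerLast {m} x x≢last = lower₁ x λ m≡x → x≢last (toℕ-injective (trans (sym m≡x) (sym (toℕ-fromℕ m))))

inject₁-lowerLast : ∀ {m} (x : Fin (suc m)) (x≢last : x ≢ fromℕ m) → inject₁ (lowerLast x x≢last) ≡ x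
inject₁-lowerLast x x≢last = inject₁-lower₁ x _

hitsLast : ∀ {m} (σ : Fin (suc m) → Fin (suc m)) → (∀ i j → σ i ≡ σ j → i ≡ j) → ∃ λ j → σ j ≡ fromℕ m
hitsLast {m} σ σ-inj with any? (λ j → σ j ≟ fromℕ m)
... | yes hit = hit
... | no miss = ⊥-elim (n≮n m (injective⇒≤ lowered-injective))
  where
  lowered : Fin (suc m) → Fin m
  lowered j = lowerLast (σ j) (λ σj≡last → miss (j , σj≡last))
  lowered-injective : ∀ {i j} → lowered i ≡ lowered j → i ≡ j
  lowered-injective {i} {j} e =
    σ-inj i j (trans (sym (inject₁-lowerLast (σ i) (λ q → miss (i , q))))
      (trans (cong inject₁ e) (inject₁-lowerLast (σ j) (λ q → miss (j , q)))))

lookup-∷ʳ-inject₁ : ∀ {A : Set} {m} (xs : Vec A m) (x : A) (i : Fin m) → lookup (xs ∷ʳ x) (inject₁ i) ≡ lookup xs i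
lookup-∷ʳ-inject₁ (y ∷ xs) x zero = refl
lookup-∷ʳ-inject₁ (y ∷ xs) x (suc i) = lookup-∷ʳ-inject₁ xs x i

lookup-∷ʳ-last : ∀ {A : Set} {m} (xs : Vec A m) (x : A) → lookup (xs ∷ʳ x) (fromℕ m) ≡ x
lookup-∷ʳ-last [] x = refl
lookup-∷ʳ-last (y ∷ xs) x = lookup-∷ʳ-last xs x

vec-ext : ∀ {A : Set} {m} {xs ys : Vec A m} → (∀ i → lookup xs i ≡ lookup ys i) → xs ≡ ys
vec-ext {xs = xs} {ys} e = trans (sym (tabulate∘lookup xs)) (trans (tabulate-cong e) (tabulate∘lookup ys))

Fixed : ∀ {A : Set} {m} → Vec A m → Vec (Fin m) m → Set
Fixed a σ = ∀ i → lookup a (lookup σ i) ≡ lookup a i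

map-fixed : ∀ {A B : Set} (f : A → B) {m} (a : Vec A m) σ → Fixed a σ → Fixed (Vec.map f a) σ
map-fixed f a σ fixed i = trans (lookup-map (lookup σ i) f a) (trans (cong f (fixed i)) (sym (lookup-map i f a)))

module _ {m : ℕ} where

  extend : Vec (Fin m) m → Vec (Fin (suc m)) (suc m)
  extend σ = Vec.map inject₁ σ ∷ʳ fromℕ m

  extend-inject₁ : ∀ σ i → lookup (extend σ) (inject₁ i) ≡ inject₁ (lookup σ i)
  extend-inject₁ σ i = trans (lookup-∷ʳ-inject₁ (Vec.map inject₁ σ) (fromℕ m) i) (lookup-map i inject₁ σ)

  extend-last : ∀ σ → lookup (extend σ) (fromℕ m) ≡ fromℕ m
  extend-last σ = lookup-∷ʳ-last (Vec.map inject₁ σ) (fromℕ m)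

  swapLast : Fin m → Fin (suc m) → Fin (suc m)
  swapLast j x with lastView x
  ... | last = inject₁ j
  ... | inj i with i ≟ j
  ...   | yes _ = fromℕ m
  ...   | no _ = inject₁ i

  swapLast-last : ∀ j x → x ≡ fromℕ m → swapLast j x ≡ inject₁ j
  swapLast-last j x x≡last with lastView x
  ... | last = refl
  ... | inj i = ⊥-elim (fromℕ≢inject₁ (sym x≡last))

  swapLast-j : ∀ j x → x ≡ inject₁ j → swapLast j x ≡ fromℕ m
  swapLast-j j x x≡j with lastView x
  ... | last = ⊥-elim (fromℕ≢inject₁ x≡j)
  ... | inj i with i ≟ j
  ...   | yes _ = refl
  ...   | no i≢j = ⊥-elim (i≢j (inject₁-injective x≡j))

  swapLast-other : ∀ j i x → x ≡ inject₁ i → i ≢ j → swapLast j x ≡ inject₁ i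
  swapLast-other j i x x≡i i≢j with lastView x
  ... | last = ⊥-elim (fromℕ≢inject₁ x≡i)
  ... | inj i′ with i′ ≟ j
  ...   | yes i′≡j = ⊥-elim (i≢j (trans (sym (inject₁-injective x≡i)) i′≡j))
  ...   | no _ = x≡i

  swapLast-involutive : ∀ j x → swapLast j (swapLast j x) ≡ x
  swapLast-involutive j x with lastView x
  ... | last = swapLast-j j (inject₁ j) refl
  ... | inj i with i ≟ j
  ...   | yes refl = swapLast-last i (fromℕ m) refl
  ...   | no i≢j = swapLast-other j i (inject₁ i) refl i≢j

  _∘swap_ : ∀ {B : Set} → Vec B (suc m) → Fin m → Vec B (suc m)
  v ∘swap j = tabulate (λ x → lookup v (swapLast j x))

  lookup-∘swap : ∀ {B : Set} (v : Vec B (suc m)) j x → lookup (v ∘swap j) x ≡ lookup v (swapLast j x)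
  lookup-∘swap v j = lookup∘tabulate (λ y → lookup v (swapLast j y))

  ∘swap-involutive : ∀ {B : Set} (v : Vec B (suc m)) j → (v ∘swap j) ∘swap j ≡ v
  ∘swap-involutive v j = vec-ext λ x →
    trans (lookup-∘swap (v ∘swap j) j x)
      (trans (lookup-∘swap v j (swapLast j x)) (cong (lookup v) (swapLast-involutive j x)))

  -- insert j σ: the new point m inserted into the cycle of σ right after j.
  insert : Fin m → Vec (Fin m) m → Vec (Fin (suc m)) (suc m)
  insert j σ = extend σ ∘swap j

  insert-j : ∀ j σ → lookup (insert j σ) (inject₁ j) ≡ fromℕ m
  insert-j j σ = trans (lookup-∘swap (extend σ) j (inject₁ j))
    (trans (cong (lookup (extend σ)) (swapLast-j j (inject₁ j) refl)) (extend-last σ))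

  insert-other : ∀ j σ i → i ≢ j → lookup (insert j σ) (inject₁ i) ≡ inject₁ (lookup σ i)
  insert-other j σ i i≢j = trans (lookup-∘swap (extend σ) j (inject₁ i))
    (trans (cong (lookup (extend σ)) (swapLast-other j i (inject₁ i) refl i≢j)) (extend-inject₁ σ i))

  insert-last : ∀ j σ → lookup (insert j σ) (fromℕ m) ≡ inject₁ (lookup σ j)
  insert-last j σ = trans (lookup-∘swap (extend σ) j (fromℕ m))
    (trans (cong (lookup (extend σ)) (swapLast-last j (fromℕ m) refl)) (extend-inject₁ σ j))

  extend-perm : ∀ σ → IsPermutation m σ ⇔ IsPermutation (suc m) (extend σ)
  extend-perm σ = mk⇔ fwd bwd
    where
    fwd : IsPermutation m σ → IsPermutation (suc m) (extend σ)
    fwd σ-inj x y = go (lastView x) (lastView y)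
      where
      go : ∀ {x y} → LastView x → LastView y → lookup (extend σ) x ≡ lookup (extend σ) y → x ≡ y
      go last last _ = refl
      go last (inj j) e = ⊥-elim (fromℕ≢inject₁ (trans (sym (extend-last σ)) (trans e (extend-inject₁ σ j))))
      go (inj i) last e = ⊥-elim (fromℕ≢inject₁ (trans (sym (extend-last σ)) (trans (sym e) (extend-inject₁ σ i))))
      go (inj i) (inj j) e =
        cong inject₁ (σ-inj i j (inject₁-injective (trans (sym (extend-inject₁ σ i)) (trans e (extend-inject₁ σ j)))))
    bwd : IsPermutation (suc m) (extend σ) → IsPermutation m σ
    bwd ext-inj i j e =
      inject₁-injective (ext-inj _ _ (trans (extend-inject₁ σ i) (trans (cong inject₁ e) (sym (extend-inject₁ σ j)))))

  ∘swap-perm : ∀ σ j → IsPermutation (suc m) σ → IsPermutation (suc m) (σ ∘swap j)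
  ∘swap-perm σ j σ-inj x y e = begin
    x                         ≡⟨ sym (swapLast-involutive j x) ⟩
    swapLast j (swapLast j x) ≡⟨ cong (swapLast j) (σ-inj _ _ (trans (sym (lookup-∘swap σ j x)) (trans e (lookup-∘swap σ j y)))) ⟩
    swapLast j (swapLast j y) ≡⟨ swapLast-involutive j y ⟩
    y                         ∎
    where open ≡-Reasoning

  insert-perm : ∀ j σ → IsPermutation m σ ⇔ IsPermutation (suc m) (insert j σ)
  insert-perm j σ = mk⇔
    (λ σ-perm → ∘swap-perm (extend σ) j (to (extend-perm σ) σ-perm))
    (λ ins-perm → from (extend-perm σ)
       (subst (IsPermutation (suc m)) (∘swap-involutive (extend σ) j) (∘swap-perm (insert j σ) j ins-perm)))

  extend-fixed : ∀ {A : Set} σ (a : Vec A m) v → Fixed a σ ⇔ Fixed (a ∷ʳ v) (extend σ)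
  extend-fixed σ a v = mk⇔ fwd bwd
    where
    b = a ∷ʳ v
    fwd : Fixed a σ → Fixed b (extend σ)
    fwd fixed x with lastView x
    ... | last = cong (lookup b) (extend-last σ)
    ... | inj i = begin
      lookup b (lookup (extend σ) (inject₁ i))  ≡⟨ cong (lookup b) (extend-inject₁ σ i) ⟩
      lookup b (inject₁ (lookup σ i))           ≡⟨ lookup-∷ʳ-inject₁ a v (lookup σ i) ⟩
      lookup a (lookup σ i)                     ≡⟨ fixed i ⟩
      lookup a i                                ≡⟨ sym (lookup-∷ʳ-inject₁ a v i) ⟩
      lookup b (inject₁ i)                      ∎
      where open ≡-Reasoning
    bwd : Fixed b (extend σ) → Fixed a σ
    bwd fixed i = begin
      lookup a (lookup σ i)                     ≡⟨ sym (lookup-∷ʳ-inject₁ a v (lookup σ i)) ⟩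
      lookup b (inject₁ (lookup σ i))           ≡⟨ cong (lookup b) (sym (extend-inject₁ σ i)) ⟩
      lookup b (lookup (extend σ) (inject₁ i))  ≡⟨ fixed (inject₁ i) ⟩
      lookup b (inject₁ i)                      ≡⟨ lookup-∷ʳ-inject₁ a v i ⟩
      lookup a i                                ∎
      where open ≡-Reasoning

  ∘swap-fixed : ∀ {A : Set} (b : Vec A (suc m)) τ j →
                (∀ x → lookup b (swapLast j x) ≡ lookup b x) → Fixed b τ → Fixed b (τ ∘swap j)
  ∘swap-fixed b τ j b-swap fixed x =
    trans (cong (lookup b) (lookup-∘swap τ j x)) (trans (fixed (swapLast j x)) (b-swap x))

  ∷ʳ-swap-invariant : ∀ {A : Set} (a : Vec A m) j x →
                      lookup (a ∷ʳ lookup a j) (swapLast j x) ≡ lookup (a ∷ʳ lookup a j) x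
  ∷ʳ-swap-invariant a j x = go (lastView x)
    where
    b = a ∷ʳ lookup a j
    go : ∀ {x} → LastView x → lookup b (swapLast j x) ≡ lookup b x
    go last = trans (cong (lookup b) (swapLast-last j _ refl)) (trans (lookup-∷ʳ-inject₁ a _ j) (sym (lookup-∷ʳ-last a _)))
    go (inj i) with i ≟ j
    ... | yes refl = trans (cong (lookup b) (swapLast-j i _ refl)) (trans (lookup-∷ʳ-last a _) (sym (lookup-∷ʳ-inject₁ a _ i)))
    ... | no i≢j = cong (lookup b) (swapLast-other j i _ refl i≢j)

  insert-fixed : ∀ {A : Set} j σ (a : Vec A m) → Fixed a σ ⇔ Fixed (a ∷ʳ lookup a j) (insert j σ)
  insert-fixed j σ a = mk⇔
    (λ fixed → ∘swap-fixed b (extend σ) j (∷ʳ-swap-invariant a j) (to (extend-fixed σ a (lookup a j)) fixed))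
    (λ fixed → from (extend-fixed σ a (lookup a j))
       (subst (Fixed b) (∘swap-involutive (extend σ) j) (∘swap-fixed b (insert j σ) j (∷ʳ-swap-invariant a j) fixed)))
    where b = a ∷ʳ lookup a j

  iter-extend : ∀ σ t i → iter (extend σ) t (inject₁ i) ≡ inject₁ (iter σ t i)
  iter-extend σ zero i = refl
  iter-extend σ (suc t) i = trans (cong (lookup (extend σ)) (iter-extend σ t i)) (extend-inject₁ σ _)

  iter-extend-last : ∀ σ t → iter (extend σ) t (fromℕ m) ≡ fromℕ m
  iter-extend-last σ zero = refl
  iter-extend-last σ (suc t) = trans (cong (lookup (extend σ)) (iter-extend-last σ t)) (extend-last σ)

  cycleMin-extend : ∀ σ i → IsCycleMin (extend σ) (inject₁ i) ⇔ IsCycleMin σ i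
  cycleMin-extend σ i = mk⇔
    (λ min t → subst₂ _≤_ (toℕ-inject₁ i) (trans (cong toℕ (iter-extend σ t i)) (toℕ-inject₁ _)) (min t))
    (λ min t → subst₂ _≤_ (sym (toℕ-inject₁ i)) (sym (trans (cong toℕ (iter-extend σ t i)) (toℕ-inject₁ _))) (min t))

  cycleMin-extend-last : ∀ σ → IsCycleMin (extend σ) (fromℕ m)
  cycleMin-extend-last σ t = ≤-reflexive (cong toℕ (sym (iter-extend-last σ t)))

  -- Orbits under insert j σ: walking from an old point i one meets old points of
  -- the σ-orbit of i, and possibly m, which is only entered from j.
  iter-insert-visits : ∀ j σ i t →
    (∃ λ u → iter (insert j σ) t (inject₁ i) ≡ inject₁ (iter σ u i)) ⊎
    (iter (insert j σ) t (inject₁ i) ≡ fromℕ m × ∃ λ u → iter σ u i ≡ j)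
  iter-insert-visits j σ i zero = inj₁ (0 , refl)
  iter-insert-visits j σ i (suc t) with iter-insert-visits j σ i t
  ... | inj₂ (at-m , u , σᵘi≡j) = inj₁ (suc u , trans (cong (lookup (insert j σ)) at-m)
                                      (trans (insert-last j σ) (cong (λ z → inject₁ (lookup σ z)) (sym σᵘi≡j))))
  ... | inj₁ (u , at) with iter σ u i ≟ j
  ...   | yes σᵘi≡j = inj₂ (trans (cong (lookup (insert j σ)) at)
                             (trans (cong (λ z → lookup (insert j σ) (inject₁ z)) σᵘi≡j) (insert-j j σ)) , u , σᵘi≡j)
  ...   | no σᵘi≢j = inj₁ (suc u , trans (cong (lookup (insert j σ)) at) (insert-other j σ _ σᵘi≢j))

  iter-insert-reaches : ∀ j σ i u → ∃ λ t → iter (insert j σ) t (inject₁ i) ≡ inject₁ (iter σ u i)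
  iter-insert-reaches j σ i zero = 0 , refl
  iter-insert-reaches j σ i (suc u) with iter-insert-reaches j σ i u
  ... | t , at with iter σ u i ≟ j
  ...   | no σᵘi≢j = suc t , trans (cong (lookup (insert j σ)) at) (insert-other j σ _ σᵘi≢j)
  ...   | yes refl = suc (suc t) , trans (cong (lookup (insert j σ)) (trans (cong (lookup (insert j σ)) at) (insert-j j σ)))
                                         (insert-last j σ)

  cycleMin-insert : ∀ j σ i → IsCycleMin (insert j σ) (inject₁ i) ⇔ IsCycleMin σ i
  cycleMin-insert j σ i = mk⇔ bwd fwd
    where
    fwd : IsCycleMin σ i → IsCycleMin (insert j σ) (inject₁ i)
    fwd min t with iter-insert-visits j σ i t
    ... | inj₁ (u , at) = subst₂ _≤_ (sym (toℕ-inject₁ i)) (sym (trans (cong toℕ at) (toℕ-inject₁ _))) (min u)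
    ... | inj₂ (at-m , _) = subst (toℕ (inject₁ i) ≤_) (cong toℕ (sym at-m))
                              (subst₂ _≤_ (sym (toℕ-inject₁ i)) (sym (toℕ-fromℕ m)) (<⇒≤ (toℕ<n i)))
    bwd : IsCycleMin (insert j σ) (inject₁ i) → IsCycleMin σ i
    bwd min u with iter-insert-reaches j σ i u
    ... | t , at = subst₂ _≤_ (toℕ-inject₁ i) (trans (cong toℕ at) (toℕ-inject₁ _)) (min t)

  ¬cycleMin-insert-last : ∀ j σ → ¬ IsCycleMin (insert j σ) (fromℕ m)
  ¬cycleMin-insert-last j σ min = <⇒≱ image<m (subst (_≤ toℕ (lookup (insert j σ) (fromℕ m))) (toℕ-fromℕ m) (min 1))
    where
    image<m : toℕ (lookup (insert j σ) (fromℕ m)) < m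
    image<m = subst (λ z → toℕ z < m) (sym (insert-last j σ))
                (subst (_< m) (sym (toℕ-inject₁ (lookup σ j))) (toℕ<n (lookup σ j)))

hasCycles-unique : ∀ {m} {σ : Vec (Fin m) m} {k₁ k₂} → HasCycles m σ k₁ → HasCycles m σ k₂ → k₁ ≡ k₂
hasCycles-unique (L₁ , u₁ , m₁ , l₁) (L₂ , u₂ , m₂ , l₂) =
  trans (sym l₁) (trans (card-cong (L₁ , u₁ , m₁) (L₂ , u₂ , m₂) (λ _ → mk⇔ (λ x → x) (λ x → x))) l₂)

module CycleTransfer {m : ℕ} (σ : Vec (Fin (suc m)) (suc m)) (σ′ : Vec (Fin m) m)
                     (mins : ∀ i → IsCycleMin σ (inject₁ i) ⇔ IsCycleMin σ′ i) where

  restrict-count : ∀ {k} → HasCycles (suc m) σ k → ∃ λ k′ → HasCycles m σ′ k′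
  restrict-count (L , u , member , _) = _ ,
    filter in-L? (allFin m) , filter⁺ in-L? (allFin⁺ m) ,
    (λ i → mk⇔ (λ i∈ → to (mins i) (to (member _) (proj₂ (∈-filter⁻ in-L? {xs = allFin m} i∈))))
               (λ min → ∈-filter⁺ in-L? (∈-allFin i) (from (member _) (from (mins i) min)))) ,
    refl
    where
    in-L? : (i : Fin m) → Dec (inject₁ i ∈ L)
    in-L? i = Any.any? (inject₁ i ≟_) L

  private
    unique-inject₁ : ∀ {L : List (Fin m)} → Unique L → Unique (map inject₁ L)
    unique-inject₁ = map⁺ inject₁-injective

    ∈-inject₁⁻ : ∀ {L : List (Fin m)} {i} → inject₁ i ∈ map inject₁ L → i ∈ L
    ∈-inject₁⁻ {L} i∈ with ∈-map⁻ inject₁ i∈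
    ... | _ , j∈ , i≡j = subst (_∈ L) (sym (inject₁-injective i≡j)) j∈

    last∉ : ∀ {L : List (Fin m)} → fromℕ m ∈ map inject₁ L → ⊥
    last∉ last∈ with ∈-map⁻ inject₁ last∈
    ... | j , _ , last≡j = fromℕ≢inject₁ last≡j

  newMin-count : IsCycleMin σ (fromℕ m) → ∀ {k} → HasCycles m σ′ k → HasCycles (suc m) σ (suc k)
  newMin-count last-min (L , u , member , len) =
    fromℕ m ∷ map inject₁ L ,
    All.tabulate (λ x∈ last≡x → last∉ (subst (_∈ map inject₁ L) (sym last≡x) x∈)) ∷ unique-inject₁ u ,
    (λ x → go (lastView x)) , cong suc (trans (length-map inject₁ L) len)
    where
    go : ∀ {x} → LastView x → (x ∈ fromℕ m ∷ map inject₁ L) ⇔ IsCycleMin σ x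
    go last = mk⇔ (λ _ → last-min) (λ _ → here refl)
    go (inj i) = mk⇔
      (λ { (here i≡last) → ⊥-elim (fromℕ≢inject₁ (sym i≡last))
         ; (there i∈) → from (mins i) (to (member i) (∈-inject₁⁻ i∈)) })
      (λ min → there (∈-map⁺ inject₁ (from (member i) (to (mins i) min))))

  oldMins-count : ¬ IsCycleMin σ (fromℕ m) → ∀ {k} → HasCycles m σ′ k → HasCycles (suc m) σ k
  oldMins-count ¬last-min (L , u , member , len) =
    map inject₁ L , unique-inject₁ u , (λ x → go (lastView x)) , trans (length-map inject₁ L) len
    where
    go : ∀ {x} → LastView x → (x ∈ map inject₁ L) ⇔ IsCycleMin σ x
    go last = mk⇔ (λ last∈ → ⊥-elim (last∉ last∈)) (λ min → ⊥-elim (¬last-min min))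
    go (inj i) = mk⇔ (λ i∈ → from (mins i) (to (member i) (∈-inject₁⁻ i∈)))
                     (λ min → ∈-map⁺ inject₁ (from (member i) (to (mins i) min)))

  newMin-count⁻ : IsCycleMin σ (fromℕ m) → ∀ {k} → HasCycles (suc m) σ k → ∃ λ k′ → k ≡ suc k′ × HasCycles m σ′ k′
  newMin-count⁻ last-min cycles with restrict-count cycles
  ... | k′ , cycles′ = k′ , hasCycles-unique cycles (newMin-count last-min cycles′) , cycles′

  oldMins-count⁻ : ¬ IsCycleMin σ (fromℕ m) → ∀ {k} → HasCycles (suc m) σ k → HasCycles m σ′ k
  oldMins-count⁻ ¬last-min cycles with restrict-count cycles
  ... | k′ , cycles′ = subst (HasCycles m σ′) (hasCycles-unique (oldMins-count ¬last-min cycles′) cycles) cycles′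

module _ {m : ℕ} where

  extend-injective : ∀ {σ σ′ : Vec (Fin m) m} → extend σ ≡ extend σ′ → σ ≡ σ′
  extend-injective {σ} {σ′} e = vec-ext λ i → inject₁-injective
    (trans (sym (extend-inject₁ σ i)) (trans (cong (λ τ → lookup τ (inject₁ i)) e) (extend-inject₁ σ′ i)))

  -- m is fixed by extend σ but not by insert j σ′.
  extend≢insert : ∀ σ j σ′ → extend σ ≢ insert j σ′
  extend≢insert σ j σ′ e =
    fromℕ≢inject₁ (trans (sym (extend-last σ)) (trans (cong (λ τ → lookup τ (fromℕ m)) e) (insert-last j σ′)))

  fixesLast⇒extend : ∀ ρ → IsPermutation (suc m) ρ → lookup ρ (fromℕ m) ≡ fromℕ m → ∃ λ σ → extend σ ≡ ρ
  fixesLast⇒extend ρ ρ-inj fix = σ , vec-ext λ x → go (lastView x)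
    where
    old≢last : ∀ i → lookup ρ (inject₁ i) ≢ fromℕ m
    old≢last i e = fromℕ≢inject₁ (ρ-inj _ _ (trans fix (sym e)))
    σ : Vec (Fin m) m
    σ = tabulate λ i → lowerLast (lookup ρ (inject₁ i)) (old≢last i)
    go : ∀ {x} → LastView x → lookup (extend σ) x ≡ lookup ρ x
    go last = trans (extend-last σ) (sym fix)
    go (inj i) = trans (extend-inject₁ σ i)
      (trans (cong inject₁ (lookup∘tabulate _ i)) (inject₁-lowerLast (lookup ρ (inject₁ i)) (old≢last i)))

  Decomposition : Vec (Fin (suc m)) (suc m) → Set
  Decomposition ρ = (∃ λ σ → extend σ ≡ ρ) ⊎ (∃ λ j → ∃ λ σ → insert j σ ≡ ρ)

  decompose : ∀ ρ → IsPermutation (suc m) ρ → Decomposition ρ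
  decompose ρ ρ-perm with hitsLast (lookup ρ) ρ-perm
  ... | x , ρx≡last = go (lastView x) ρx≡last
    where
    go : ∀ {x} → LastView x → lookup ρ x ≡ fromℕ m → Decomposition ρ
    go last fix = inj₁ (fixesLast⇒extend ρ ρ-perm fix)
    go (inj j) ρj≡last with fixesLast⇒extend (ρ ∘swap j) (∘swap-perm ρ j ρ-perm) swapped-fix
      where
      swapped-fix : lookup (ρ ∘swap j) (fromℕ m) ≡ fromℕ m
      swapped-fix = trans (lookup-∘swap ρ j (fromℕ m)) (trans (cong (lookup ρ) (swapLast-last j _ refl)) ρj≡last)
    ... | σ , ext≡ = inj₂ (j , σ , trans (cong (_∘swap j) ext≡) (∘swap-involutive ρ j))

module InvariantPairs (N : ℕ) where

  Pair : ℕ → Set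
  Pair m = Vec (Fin m) m × Vec (Fin N) m

  Invariant : ∀ m → ℕ → Pair m → Set
  Invariant m k (σ , a) = IsPermutation m σ × HasCycles m σ k × Fixed a σ

  -- The data from which a pair of size m+1 is built: m becomes a new fixed
  -- point carrying a letter v, or m is inserted after j carrying the letter a_j.
  Build : ℕ → Set
  Build m = (Fin N × Pair m) ⊎ (Fin m × Pair m)

  build : ∀ {m} → Build m → Pair (suc m)
  build (inj₁ (v , σ , a)) = extend σ , a ∷ʳ v
  build (inj₂ (j , σ , a)) = insert j σ , a ∷ʳ lookup a j

  -- A new fixed point is a new cycle; an insertion keeps the number of cycles.
  ValidNew : ∀ {m} → ℕ → Fin N × Pair m → Set
  ValidNew zero _ = ⊥
  ValidNew {m} (suc k) (_ , p) = Invariant m k p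

  ValidInsert : ∀ {m} → ℕ → Fin m × Pair m → Set
  ValidInsert {m} k (_ , p) = Invariant m k p

  Valid : ∀ {m} → ℕ → Build m → Set
  Valid k = [ ValidNew k , ValidInsert k ]′

  module _ {m : ℕ} where
    open CycleTransfer

    build-invariant : ∀ k w → Valid k w → Invariant (suc m) k (build {m} w)
    build-invariant (suc k) (inj₁ (v , σ , a)) (perm , cycles , fixed) =
      to (extend-perm σ) perm ,
      newMin-count (extend σ) σ (cycleMin-extend σ) (cycleMin-extend-last σ) cycles ,
      to (extend-fixed σ a v) fixed
    build-invariant k (inj₂ (j , σ , a)) (perm , cycles , fixed) =
      to (insert-perm j σ) perm ,
      oldMins-count (insert j σ) σ (cycleMin-insert j σ) (¬cycleMin-insert-last j σ) cycles ,
      to (insert-fixed j σ a) fixed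

    -- Whether m is fixed tells the two kinds of data apart.
    build-injective : ∀ k {w w′} → Valid k w → Valid k w′ → build {m} w ≡ build w′ → w ≡ w′
    build-injective k {inj₁ (v , σ , a)} {inj₁ (v′ , σ′ , a′)} _ _ e
      with ∷ʳ-injective a a′ (cong proj₂ e) | extend-injective (cong proj₁ e)
    ... | refl , refl | refl = refl
    build-injective k {inj₁ (v , σ , a)} {inj₂ (j′ , σ′ , a′)} _ _ e = ⊥-elim (extend≢insert σ j′ σ′ (cong proj₁ e))
    build-injective k {inj₂ (j , σ , a)} {inj₁ (v′ , σ′ , a′)} _ _ e = ⊥-elim (extend≢insert σ′ j σ (sym (cong proj₁ e)))
    build-injective k {inj₂ (j , σ , a)} {inj₂ (j′ , σ′ , a′)} valid _ e with same-j
      where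
      -- j is recovered as the preimage of m.
      same-j : j ≡ j′
      same-j = inject₁-injective (proj₁ (build-invariant k (inj₂ (j , σ , a)) valid) _ _
        (trans (insert-j j σ) (sym (trans (cong (λ τ → lookup τ (inject₁ j′)) (cong proj₁ e)) (insert-j j′ σ′)))))
    ... | refl with ∷ʳ-injective a a′ (cong proj₂ e)
                  | extend-injective (trans (sym (∘swap-involutive (extend σ) j))
                                       (trans (cong (_∘swap j) (cong proj₁ e)) (∘swap-involutive (extend σ′) j)))
    ...   | refl , _ | refl = refl

    build-onto : ∀ k y → Invariant (suc m) k y → ∃ λ w → Valid k w × build {m} w ≡ y
    build-onto k (ρ , b) (perm , cycles , fixed) with decompose ρ perm | initLast b
    ... | inj₁ (σ , refl) | a , v , refl
      with newMin-count⁻ (extend σ) σ (cycleMin-extend σ) (cycleMin-extend-last σ) cycles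
    ...   | k′ , refl , cycles′ =
      inj₁ (v , σ , a) , (from (extend-perm σ) perm , cycles′ , from (extend-fixed σ a v) fixed) , refl
    build-onto k (ρ , b) (perm , cycles , fixed) | inj₂ (j , σ , refl) | a , v , refl =
      inj₂ (j , σ , a) ,
      (from (insert-perm j σ) perm ,
       oldMins-count⁻ (insert j σ) σ (cycleMin-insert j σ) (¬cycleMin-insert-last j σ) cycles ,
       from (insert-fixed j σ a) (subst (λ u → Fixed (a ∷ʳ u) (insert j σ)) v≡aj fixed)) ,
      cong (λ u → insert j σ , a ∷ʳ u) (sym v≡aj)
      where
      -- invariance at j forces the letter of m to be a_j
      v≡aj : v ≡ lookup a j
      v≡aj = begin
        v                                             ≡⟨ sym (lookup-∷ʳ-last a v) ⟩
        lookup (a ∷ʳ v) (fromℕ m)                     ≡⟨ cong (lookup (a ∷ʳ v)) (sym (insert-j j σ)) ⟩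
        lookup (a ∷ʳ v) (lookup (insert j σ) (inject₁ j)) ≡⟨ fixed (inject₁ j) ⟩
        lookup (a ∷ʳ v) (inject₁ j)                   ≡⟨ lookup-∷ʳ-inject₁ a v j ⟩
        lookup a j                                    ∎
        where open ≡-Reasoning

  count-invariant : ∀ m k → Σ (Enumeration (Invariant m k)) λ e → card e ≡ coeff k (Rising N m)
  count-invariant zero zero =
    (([] , []) ∷ [] , [] ∷ [] , λ { ([] , []) → mk⇔ (λ _ → empty-invariant) (λ _ → here refl) }) , refl
    where
    empty-invariant : Invariant 0 0 ([] , [])
    empty-invariant = (λ ()) , ([] , [] , (λ ()) , refl) , (λ ())
  count-invariant zero (suc k) = enumerate-∅ λ { ([] , []) (_ , cycles , _) → no-cycles cycles }
    where
    no-cycles : ¬ HasCycles 0 [] (suc k)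
    no-cycles ([] , _ , _ , ())
    no-cycles ((() ∷ _) , _)
  count-invariant (suc m) k =
    let (builds , #builds) = enumerate-⊎ (proj₁ (new k)) (proj₁ inserted)
        (pairs , #pairs) = enumerate-image build (build-injective k) (build-invariant k) (build-onto k) builds
    in pairs , (begin
      card pairs                                             ≡⟨ #pairs ⟩
      card builds                                            ≡⟨ #builds ⟩
      card (proj₁ (new k)) + card (proj₁ inserted)           ≡⟨ cong₂ _+_ (proj₂ (new k)) (proj₂ inserted) ⟩
      N * coeffBelow k R + m * coeff k R                     ≡⟨ +-comm (N * coeffBelow k R) (m * coeff k R) ⟩
      m * coeff k R + N * coeffBelow k R                     ≡⟨ sym (coeff-⊗-linear k R m N) ⟩
      coeff k (Rising N (suc m))                             ∎)
    where
    open ≡-Reasoning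
    R = Rising N m
    new : ∀ k → Σ (Enumeration (ValidNew {m} k)) λ e → card e ≡ N * coeffBelow k R
    new zero = let (e , #e) = enumerate-∅ (λ _ ()) in e , trans #e (sym (*-zeroʳ N))
    new (suc k) =
      let (e , #e) = enumerate-Fin× N (proj₁ (count-invariant m k))
      in e , trans #e (cong (N *_) (proj₂ (count-invariant m k)))
    inserted : Σ (Enumeration (ValidInsert {m} k)) λ e → card e ≡ m * coeff k R
    inserted =
      let (e , #e) = enumerate-Fin× m (proj₁ (count-invariant m k))
      in e , trans #e (cong (m *_) (proj₂ (count-invariant m k)))

count : {A : Set} {P : A → Set} → Decidable P → List A → ℕ
count P? xs = length (filter P? xs)

module _ {A : Set} {P : A → Set} (P? : Decidable P) where

  count-↭ : ∀ {xs ys} → xs ↭ ys → count P? xs ≡ count P? ys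
  count-↭ xs↭ys = ↭-length (filter-↭ P? xs↭ys)

  count-≤-length : ∀ xs → count P? xs ≤ length xs
  count-≤-length = length-filter P?

  count-accept : ∀ {x xs} → P x → count P? (x ∷ xs) ≡ suc (count P? xs)
  count-accept px = cong length (filter-accept P? px)

  count-none : ∀ {xs} → All (∁ P) xs → count P? xs ≡ 0
  count-none none = cong length (filter-none P? none)

  count-full : ∀ xs → length xs ≤ count P? xs → All P xs
  count-full [] _ = []
  count-full (x ∷ xs) full with P? x
  ... | yes px = px ∷ count-full xs (≤-pred full)
  ... | no _ = ⊥-elim (<⇒≱ (s≤s (count-≤-length xs)) full)

  count-map : {B : Set} (f : B → A) (xs : List B) → count P? (map f xs) ≡ count (λ x → P? (f x)) xs
  count-map f [] = refl
  count-map f (x ∷ xs) with P? (f x)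
  ... | yes _ = cong suc (count-map f xs)
  ... | no _ = count-map f xs

  count-complement : ∀ xs → count P? xs + count (∁? P?) xs ≡ length xs
  count-complement [] = refl
  count-complement (x ∷ xs) with P? x
  ... | yes _ = cong suc (count-complement xs)
  ... | no _ = trans (+-suc (count P? xs) _) (cong suc (count-complement xs))

  count-split : {Q : A → Set} (Q? : Decidable Q) (xs : List A) →
                count Q? xs ≡ count (Q? ∩? P?) xs + count (Q? ∩? ∁? P?) xs
  count-split Q? [] = refl
  count-split Q? (x ∷ xs) with Q? x | P? x
  ... | yes _ | yes _ = cong suc (count-split Q? xs)
  ... | yes _ | no _ = trans (cong suc (count-split Q? xs)) (sym (+-suc _ _))
  ... | no _ | yes _ = count-split Q? xs
  ... | no _ | no _ = count-split Q? xs

count-cong : {A : Set} {P Q : A → Set} (P? : Decidable P) (Q? : Decidable Q) {xs : List A} →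
             All (λ x → P x ⇔ Q x) xs → count P? xs ≡ count Q? xs
count-cong P? Q? [] = refl
count-cong P? Q? {x ∷ xs} (P⇔Q ∷ rest) with P? x | Q? x
... | yes _ | yes _ = cong suc (count-cong P? Q? rest)
... | no _ | no _ = count-cong P? Q? rest
... | yes px | no ¬qx = ⊥-elim (¬qx (to P⇔Q px))
... | no ¬px | yes qx = ⊥-elim (¬px (from P⇔Q qx))

-- For a list π read with positions s, s+1, …: π_i ≤ s + i holds for all i iff,
-- for each j < |π|, at least j+1 entries are ≤ s + j (the second direction
-- needs π nondecreasing).
boundedFrom⇒counts : ∀ s π → BoundedFrom s π → ∀ j → j < length π → suc j ≤ count (_≤? s + j) π
boundedFrom⇒counts s (x ∷ π) (x≤s , bounded) j j< =
  subst (suc j ≤_) (sym (count-accept (_≤? s + j) (≤-trans x≤s (m≤m+n s j)))) (s≤s (tail j j<))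
  where
  tail : ∀ j → j < suc (length π) → j ≤ count (_≤? s + j) π
  tail zero _ = z≤n
  tail (suc j) (s≤s j<) = subst (λ b → suc j ≤ count (_≤? b) π) (sym (+-suc s j)) (boundedFrom⇒counts (suc s) π bounded j j<)

counts⇒boundedFrom : ∀ s π → Linked _≤_ π → (∀ j → j < length π → suc j ≤ count (_≤? s + j) π) → BoundedFrom s π
counts⇒boundedFrom s [] _ _ = tt
counts⇒boundedFrom s (x ∷ π) sorted counts = x≤s , counts⇒boundedFrom (suc s) π (Linked.tail sorted) tail-counts
  where
  -- if the least entry exceeded s, no entry would be ≤ s + 0
  x≤s : x ≤ s
  x≤s with x ≤? s
  ... | yes x≤s = x≤s
  ... | no x≰s = ⊥-elim (n≮n 0 (subst (1 ≤_) none (counts 0 (s≤s z≤n))))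
    where
    above : All (λ y → ¬ y ≤ s + 0) (x ∷ π)
    above = All.map (λ {y} x≤y y≤s → x≰s (≤-trans x≤y (subst (y ≤_) (+-identityʳ s) y≤s)))
                    (Linked⇒All ≤-trans ≤-refl sorted)
    none : count (_≤? s + 0) (x ∷ π) ≡ 0
    none = count-none (_≤? s + 0) above
  -- the head is counted at every threshold, so the tail needs one entry less
  tail-counts : ∀ j → j < length π → suc j ≤ count (_≤? suc s + j) π
  tail-counts j j< = subst (λ b → suc j ≤ count (_≤? b) π) (+-suc s j)
    (≤-pred (subst (suc (suc j) ≤_) (count-accept (_≤? s + suc j) (≤-trans x≤s (m≤m+n s (suc j)))) (counts (suc j) (s≤s j<))))

-- The counting form of the parking condition: at least j letters lie in [1, j].
InRange : ℕ → ℕ → Set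
InRange j x = 1 ≤ x × x ≤ j

inRange? : ∀ j → Decidable (InRange j)
inRange? j x = (1 ≤? x) ×-dec (x ≤? j)

ParkingCounts : ℕ → List ℕ → Set
ParkingCounts n xs = ∀ j → j ≤ n → j ≤ count (inRange? j) xs

parkingCounts⇒inRange : ∀ {n} xs → length xs ≡ n → ParkingCounts n xs → All (InRange n) xs
parkingCounts⇒inRange {n} xs len counts =
  count-full (inRange? n) xs (subst (_≤ count (inRange? n) xs) (sym len) (counts n ≤-refl))

-- A word is a parking function iff it satisfies the counting form: sorting does
-- not change counts, and positivity turns "≤ j" into "∈ [1, j]".
parking⇔counts : ∀ n (a : Vec ℕ n) → IsParkingFunction n a ⇔ ParkingCounts n (toList a)
parking⇔counts n a = mk⇔ fwd bwd
  where
  xs = toList a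
  π = sort xs
  length-π : length π ≡ n
  length-π = trans (↭-length (sort-↭ xs)) (length-toList a)
  positive-counts : All (1 ≤_) xs → ∀ j → count (_≤? j) π ≡ count (inRange? j) xs
  positive-counts pos j = trans (count-↭ (_≤? j) (sort-↭ xs))
    (count-cong (_≤? j) (inRange? j) (All.map (λ 1≤x → mk⇔ (1≤x ,_) proj₂) pos))
  fwd : IsParkingFunction n a → ParkingCounts n xs
  fwd _ zero _ = z≤n
  fwd (pos , bounded) (suc j) j≤n =
    subst (suc j ≤_) (positive-counts (VecAll.toList⁺ (VecAll.lookup⁻ pos)) (suc j))
      (boundedFrom⇒counts 1 π bounded j (subst (j <_) (sym length-π) j≤n))
  bwd : ParkingCounts n xs → IsParkingFunction n a
  bwd counts = VecAll.lookup⁺ (VecAll.toList⁻ pos) , counts⇒boundedFrom 1 π (sort-↗ xs) λ j j< →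
      subst (suc j ≤_) (sym (positive-counts pos (suc j))) (counts (suc j) (subst (suc j ≤_) length-π j<))
    where
    pos : All (1 ≤_) xs
    pos = All.map proj₁ (parkingCounts⇒inRange xs (length-toList a) counts)

-- y is the lowest point of t ↦ A t − t on [1, M] (the first place where the
-- minimum is attained), written without subtraction.
LowestPoint : (ℕ → ℕ) → ℕ → ℕ → Set
LowestPoint A M y =
  (∀ t → y ≤ t → t ≤ M → A y + t ≤ A t + y) × (∀ t → 1 ≤ t → t < y → A y + t < A t + y)

balance-<-≤ : ∀ a b c p q r → a + q < b + p → b + r ≤ c + q → a + r < c + p
balance-<-≤ a b c p q r a+q<b+p b+r≤c+q = +-cancelʳ-< (b + q) (a + r) (c + p)
  (subst₂ _<_ (left a q b r) (right b p c q) (+-mono-<-≤ a+q<b+p b+r≤c+q))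
  where
  left : ∀ a q b r → a + q + (b + r) ≡ a + r + (b + q)
  left = solve-∀
  right : ∀ b p c q → b + p + (c + q) ≡ c + p + (b + q)
  right = solve-∀

lowestPoint-exists : ∀ A M → 1 ≤ M → ∃ λ y → 1 ≤ y × y ≤ M × LowestPoint A M y
lowestPoint-exists A (suc zero) _ =
  1 , ≤-refl , ≤-refl , (λ t 1≤t t≤1 → subst (λ t → A 1 + t ≤ A t + 1) (≤-antisym 1≤t t≤1) ≤-refl) ,
  λ t 1≤t t<1 → ⊥-elim (<⇒≱ t<1 1≤t)
lowestPoint-exists A (suc (suc M)) _ with lowestPoint-exists A (suc M) (s≤s z≤n)
... | y , 1≤y , y≤M , after , before with A (suc (suc M)) + y <? A y + suc (suc M)
...   | yes M′-lower = suc (suc M) , s≤s z≤n , ≤-refl ,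
          (λ t M′≤t t≤M′ → subst (λ t → A M′ + t ≤ A t + M′) (≤-antisym M′≤t t≤M′) ≤-refl) ,
          λ t 1≤t t<M′ → new-before t 1≤t (≤-pred t<M′)
  where
  M′ = suc (suc M)
  new-before : ∀ t → 1 ≤ t → t ≤ suc M → A M′ + t < A t + M′
  new-before t 1≤t t≤M with t <? y
  ... | yes t<y = balance-<-≤ (A M′) (A y) (A t) M′ y t M′-lower (<⇒≤ (before t 1≤t t<y))
  ... | no t≮y = balance-<-≤ (A M′) (A y) (A t) M′ y t M′-lower (after t (≮⇒≥ t≮y) t≤M)
...   | no M′-not-lower = y , 1≤y , m≤n⇒m≤1+n y≤M , new-after , before
  where
  new-after : ∀ t → y ≤ t → t ≤ suc (suc M) → A y + t ≤ A t + y
  new-after t y≤t t≤M′ with m≤n⇒m<n∨m≡n t≤M′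
  ... | inj₁ t<M′ = after t y≤t (≤-pred t<M′)
  ... | inj₂ refl = ≮⇒≥ M′-not-lower

lowestPoint-unique : ∀ A M {y₁ y₂} → 1 ≤ y₁ → y₁ ≤ M → 1 ≤ y₂ → y₂ ≤ M →
                     LowestPoint A M y₁ → LowestPoint A M y₂ → y₁ ≡ y₂
lowestPoint-unique A M {y₁} {y₂} 1≤y₁ y₁≤M 1≤y₂ y₂≤M (after₁ , before₁) (after₂ , before₂) with <-cmp y₁ y₂
... | tri≈ _ y₁≡y₂ _ = y₁≡y₂
... | tri< y₁<y₂ _ _ =
  ⊥-elim (<-irrefl refl (<-≤-trans (before₂ y₁ 1≤y₁ y₁<y₂) (after₁ y₂ (<⇒≤ y₁<y₂) y₂≤M)))
... | tri> _ _ y₂<y₁ =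
  ⊥-elim (<-irrefl refl (<-≤-trans (before₁ y₂ 1≤y₂ y₂<y₁) (after₂ y₁ (<⇒≤ y₂<y₁) y₁≤M)))

window⇔ : ∀ s d j → (s + d < suc s + j) ⇔ (d ≤ j)
window⇔ s d j = mk⇔ (λ s+d<1+s+j → +-cancelˡ-≤ s d j (≤-pred s+d<1+s+j)) (λ d≤j → s≤s (+-monoʳ-≤ s d≤j))

above⇔positive : ∀ s d → (¬ s + d < suc s) ⇔ (1 ≤ d)
above⇔positive s zero = mk⇔ (λ s≮1+s → ⊥-elim (s≮1+s (s≤s (≤-reflexive (+-identityʳ s))))) (λ ())
above⇔positive s (suc d) = mk⇔ (λ _ → s≤s z≤n)
  (λ _ s+d<1+s → <⇒≱ s+d<1+s (subst (suc s ≤_) (sym (+-suc s d)) (s≤s (m≤m+n s d))))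

wrapped⇔ : ∀ x m t → (x + suc m ≤ m + t) ⇔ (x < t)
wrapped⇔ x m t = mk⇔
  (λ le → +-cancelʳ-≤ m (suc x) t (subst₂ _≤_ (+-suc x m) (+-comm m t) le))
  (λ x<t → subst₂ _≤_ (sym (+-suc x m)) (+-comm t m) (+-monoˡ-≤ m x<t))

low-comparison : ∀ a b c y j → a + c ≡ b → (a + (y + j) ≤ b + y) ⇔ (j ≤ c)
low-comparison a b c y j a+c≡b = mk⇔
  (λ le → +-cancelˡ-≤ a j c (subst (a + j ≤_) (sym a+c≡b) (+-cancelʳ-≤ y (a + j) b (subst (_≤ b + y) (shuffle a y j) le))))
  (λ j≤c → subst (_≤ b + y) (sym (shuffle a y j)) (+-monoˡ-≤ y (subst (a + j ≤_) a+c≡b (+-monoʳ-≤ a j≤c))))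
  where
  shuffle : ∀ a y j → a + (y + j) ≡ a + j + y
  shuffle = solve-∀

high-comparison : ∀ a b c n s t u → c + a ≡ n + b → u + s ≡ n → (a + t < b + suc s) ⇔ (u + t ≤ c)
high-comparison a b c n s t u c+a≡n+b u+s≡n = mk⇔
  (λ lt → +-cancelʳ-≤ a (u + t) c (subst₂ _≤_ (left a t u) (right b s u c a n c+a≡n+b u+s≡n)
            (+-monoˡ-≤ u (≤-pred (subst (a + t <_) (+-suc b s) lt)))))
  (λ le → subst (a + t <_) (sym (+-suc b s)) (s≤s (+-cancelʳ-≤ u (a + t) (b + s)
            (subst₂ _≤_ (sym (left a t u)) (sym (right b s u c a n c+a≡n+b u+s≡n)) (+-monoˡ-≤ a le)))))
  where
  left : ∀ a t u → a + t + u ≡ u + t + a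
  left = solve-∀
  right : ∀ b s u c a n → c + a ≡ n + b → u + s ≡ n → b + s + u ≡ c + a
  right b s u c a n c+a≡n+b u+s≡n = trans (shuffle b s u) (trans (cong (_+ b) u+s≡n) (sym c+a≡n+b))
    where
    shuffle : ∀ b s u → b + s + u ≡ u + s + b
    shuffle = solve-∀

module Rotation (n : ℕ) where

  N : ℕ
  N = suc n

  shift : ℕ → Fin N → Fin N
  shift c x = fromℕ< (m%n<n (toℕ x + c) N)

  toℕ-shift : ∀ c x → toℕ (shift c x) ≡ (toℕ x + c) % N
  toℕ-shift c x = toℕ-fromℕ< (m%n<n (toℕ x + c) N)

  %-absorbˡ : ∀ a b → (a % N + b) % N ≡ (a + b) % N
  %-absorbˡ a b = begin
    (a % N + b) % N            ≡⟨ %-distribˡ-+ (a % N) b N ⟩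
    (a % N % N + b % N) % N    ≡⟨ cong (λ z → (z + b % N) % N) (m%n%n≡m%n a N) ⟩
    (a % N + b % N) % N        ≡⟨ sym (%-distribˡ-+ a b N) ⟩
    (a + b) % N                ∎
    where open ≡-Reasoning

  shift-inverse : ∀ c d → c + d ≡ N → ∀ x → shift d (shift c x) ≡ x
  shift-inverse c d c+d≡N x = toℕ-injective (begin
    toℕ (shift d (shift c x))  ≡⟨ toℕ-shift d (shift c x) ⟩
    (toℕ (shift c x) + d) % N  ≡⟨ cong (λ z → (z + d) % N) (toℕ-shift c x) ⟩
    ((toℕ x + c) % N + d) % N  ≡⟨ %-absorbˡ (toℕ x + c) d ⟩
    (toℕ x + c + d) % N        ≡⟨ cong (_% N) (trans (+-assoc (toℕ x) c d) (cong (toℕ x +_) c+d≡N)) ⟩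
    (toℕ x + N) % N            ≡⟨ [m+n]%n≡m%n (toℕ x) N ⟩
    toℕ x % N                  ≡⟨ m<n⇒m%n≡m (toℕ<n x) ⟩
    toℕ x                      ∎)
    where open ≡-Reasoning

  rotate : Fin N → ∀ {m} → Vec (Fin N) m → Vec (Fin N) m
  rotate s = Vec.map (shift (N ∸ toℕ s))

  unrotate : Fin N → ∀ {m} → Vec (Fin N) m → Vec (Fin N) m
  unrotate s = Vec.map (shift (toℕ s))

  unrotate-rotate : ∀ s {m} (a : Vec (Fin N) m) → unrotate s (rotate s a) ≡ a
  unrotate-rotate s [] = refl
  unrotate-rotate s (x ∷ a) =
    cong₂ _∷_ (shift-inverse (N ∸ toℕ s) (toℕ s) (m∸n+n≡m (<⇒≤ (toℕ<n s))) x) (unrotate-rotate s a)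

  rotate-unrotate : ∀ s {m} (a : Vec (Fin N) m) → rotate s (unrotate s a) ≡ a
  rotate-unrotate s [] = refl
  rotate-unrotate s (x ∷ a) =
    cong₂ _∷_ (shift-inverse (toℕ s) (N ∸ toℕ s) (m+[n∸m]≡n (<⇒≤ (toℕ<n s))) x) (rotate-unrotate s a)

  rot : ℕ → ℕ → ℕ
  rot s x = (x + (N ∸ s)) % N

  letters : ∀ {m} → Vec (Fin N) m → List ℕ
  letters a = toList (Vec.map toℕ a)

  letters-rotate : ∀ s {m} (a : Vec (Fin N) m) → letters (rotate s a) ≡ map (rot (toℕ s)) (letters a)
  letters-rotate s [] = refl
  letters-rotate s (x ∷ a) = cong₂ _∷_ (toℕ-shift (N ∸ toℕ s) x) (letters-rotate s a)

  data RotView (s : ℕ) : ℕ → Set where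
    wraps : ∀ {x} → x < s → rot s x ≡ x + suc (n ∸ s) → RotView s x
    drops : ∀ d → d ≤ n ∸ s → rot s (s + d) ≡ d → RotView s (s + d)

  rotView : ∀ s x → s ≤ n → x < N → RotView s x
  rotView s x s≤n x<N with x <? s
  ... | yes x<s = wraps x<s (trans (cong (λ z → (x + z) % N) N∸s) (m<n⇒m%n≡m wrapped<N))
    where
    N∸s : N ∸ s ≡ suc (n ∸ s)
    N∸s = +-∸-assoc 1 s≤n
    wrapped<N : x + suc (n ∸ s) < N
    wrapped<N = subst (x + suc (n ∸ s) <_) (trans (+-suc s (n ∸ s)) (cong suc (m+[n∸m]≡n s≤n)))
                  (+-monoˡ-< (suc (n ∸ s)) x<s)
  ... | no x≮s = subst (RotView s) (m+[n∸m]≡n s≤x) (drops d (∸-monoˡ-≤ s (≤-pred x<N)) dropped)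
    where
    s≤x = ≮⇒≥ x≮s
    d = x ∸ s
    d<N : d < N
    d<N = ≤-<-trans (m∸n≤m x s) x<N
    dropped : rot s (s + d) ≡ d
    dropped = begin
      (s + d + (N ∸ s)) % N     ≡⟨ cong (_% N) (rearrange s d (N ∸ s)) ⟩
      (d + (s + (N ∸ s))) % N   ≡⟨ cong (λ z → (d + z) % N) (m+[n∸m]≡n (m≤n⇒m≤1+n s≤n)) ⟩
      (d + N) % N               ≡⟨ [m+n]%n≡m%n d N ⟩
      d % N                     ≡⟨ m<n⇒m%n≡m d<N ⟩
      d                         ∎
      where
      open ≡-Reasoning
      rearrange : ∀ s d e → s + d + e ≡ d + (s + e)
      rearrange = solve-∀

  module Counts (xs : List ℕ) (xs<N : All (_< N) xs) (length-xs : length xs ≡ n) where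

    A : ℕ → ℕ
    A t = count (_<? t) xs

    -- Small windows [1, j] (s + j ≤ n) pull back to [s+1, s+j].
    count-rot-low : ∀ s j → s + j ≤ n → A (suc s) + count (inRange? j) (map (rot s) xs) ≡ A (suc s + j)
    count-rot-low s j s+j≤n = begin
      A y + count (inRange? j) (map (rot s) xs)                              ≡⟨ cong (A y +_) (count-map (inRange? j) (rot s) xs) ⟩
      A y + count (λ x → inRange? j (rot s x)) xs                            ≡⟨ cong₂ _+_ (sym below-y) (sym window) ⟩
      count ((_<? y + j) ∩? (_<? y)) xs + count ((_<? y + j) ∩? ∁? (_<? y)) xs ≡⟨ sym (count-split (_<? y) (_<? y + j) xs) ⟩
      A (y + j)                                                              ∎
      where
      open ≡-Reasoning
      y = suc s
      below-y : count ((_<? y + j) ∩? (_<? y)) xs ≡ A y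
      below-y = count-cong _ (_<? y) (All.map (λ _ → mk⇔ proj₂ λ x<y → <-≤-trans x<y (m≤m+n y j) , x<y) xs<N)
      same : ∀ {x} → RotView s x → (x < y + j × ¬ x < y) ⇔ InRange j (rot s x)
      same (wraps x<s rot≡) rewrite rot≡ = mk⇔ (λ (_ , x≮y) → ⊥-elim (x≮y (m≤n⇒m≤1+n x<s)))
                               (λ (_ , rot≤j) → ⊥-elim (<⇒≱ (j<rot x<s) rot≤j))
        where
        j<rot : ∀ {x} → x < s → j < x + suc (n ∸ s)
        j<rot {x} _ = subst (j <_) (sym (+-suc x (n ∸ s)))
          (s≤s (≤-trans (subst (_≤ n ∸ s) (m+n∸m≡n s j) (∸-monoˡ-≤ s s+j≤n)) (m≤n+m (n ∸ s) x)))
      same (drops d _ rot≡d) rewrite rot≡d = mk⇔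
        (λ (in-window , above) → to (above⇔positive s d) above , to (window⇔ s d j) in-window)
        (λ (1≤d , d≤j) → from (window⇔ s d j) d≤j , from (above⇔positive s d) 1≤d)
      window : count ((_<? y + j) ∩? ∁? (_<? y)) xs ≡ count (λ x → inRange? j (rot s x)) xs
      window = count-cong _ _ (All.map (λ {x} x<N → same (rotView s x (≤-trans (m≤m+n s j) s+j≤n) x<N)) xs<N)

    -- Large windows [1, (n − s) + t] (t ≤ s) pull back to [s+1, n] and [0, t).
    count-rot-high : ∀ s t → t ≤ s → s ≤ n → count (inRange? (n ∸ s + t)) (map (rot s) xs) + A (suc s) ≡ n + A t
    count-rot-high s t t≤s s≤n = begin
      count (inRange? w) (map (rot s) xs) + A y                          ≡⟨ cong (_+ A y) (count-map (inRange? w) (rot s) xs) ⟩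
      count D? xs + A y                                                  ≡⟨ cong (_+ A y) (count-split (_<? y) D? xs) ⟩
      count (D? ∩? (_<? y)) xs + count (D? ∩? ∁? (_<? y)) xs + A y        ≡⟨ cong (λ z → z + A y) (cong₂ _+_ below-t above-s) ⟩
      A t + count (∁? (_<? y)) xs + A y                                  ≡⟨ rearrange (A t) (count (∁? (_<? y)) xs) (A y) ⟩
      A t + (A y + count (∁? (_<? y)) xs)                                ≡⟨ cong (A t +_) (count-complement (_<? y) xs) ⟩
      A t + length xs                                                    ≡⟨ cong (A t +_) length-xs ⟩
      A t + n                                                            ≡⟨ +-comm (A t) n ⟩
      n + A t                                                            ∎
      where
      open ≡-Reasoning
      y = suc s
      w = n ∸ s + t
      D? : Decidable (λ x → InRange w (rot s x))
      D? x = inRange? w (rot s x)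
      rearrange : ∀ a c b → a + c + b ≡ a + (b + c)
      rearrange = solve-∀
      inside : ∀ {x} → RotView s x → (InRange w (rot s x) × x < y) ⇔ x < t
      inside (wraps x<s rot≡) rewrite rot≡ = mk⇔
        (λ ((_ , in-w) , _) → to (wrapped⇔ _ (n ∸ s) t) in-w)
        (λ x<t → (≤-trans (s≤s z≤n) (m≤n+m _ _) , from (wrapped⇔ _ (n ∸ s) t) x<t) , m≤n⇒m≤1+n x<s)
      inside (drops d _ rot≡) rewrite rot≡ = mk⇔
        (λ ((1≤d , _) , s+d<y) → ⊥-elim (from (above⇔positive s d) 1≤d s+d<y))
        (λ s+d<t → ⊥-elim (<⇒≱ s+d<t (≤-trans t≤s (m≤m+n s d))))
      outside : ∀ {x} → RotView s x → (InRange w (rot s x) × ¬ x < y) ⇔ (¬ x < y)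
      outside (wraps x<s _) = mk⇔ proj₂ (λ x≮y → ⊥-elim (x≮y (m≤n⇒m≤1+n x<s)))
      outside (drops d d≤ rot≡) rewrite rot≡ = mk⇔ proj₂
        (λ s+d≮y → (to (above⇔positive s d) s+d≮y , ≤-trans d≤ (m≤m+n (n ∸ s) t)) , s+d≮y)
      below-t : count (D? ∩? (_<? y)) xs ≡ A t
      below-t = count-cong _ _ (All.map (λ {x} x<N → inside (rotView s x s≤n x<N)) xs<N)
      above-s : count (D? ∩? ∁? (_<? y)) xs ≡ count (∁? (_<? y)) xs
      above-s = count-cong _ _ (All.map (λ {x} x<N → outside (rotView s x s≤n x<N)) xs<N)

    -- The rotation sending s to 0 yields a parking function exactly when
    -- s + 1 is the lowest point of t ↦ A t − t on [1, N]: windows below n − s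
    -- give the comparisons after s + 1, larger windows those before it.
    rotation-parking⇒lowest : ∀ s → s ≤ n → ParkingCounts n (map (rot s) xs) → LowestPoint A N (suc s)
    rotation-parking⇒lowest s s≤n counts = after , before
      where
      y = suc s
      after : ∀ t → y ≤ t → t ≤ N → A y + t ≤ A t + y
      after t y≤t t≤N = subst (λ t → A y + t ≤ A t + y) (m+[n∸m]≡n y≤t)
        (from (low-comparison (A y) (A (y + j)) _ y j (count-rot-low s j s+j≤n)) (counts j (≤-trans (m≤n+m j s) s+j≤n)))
        where
        j = t ∸ y
        s+j≤n : s + j ≤ n
        s+j≤n = ≤-pred (subst (_≤ N) (sym (m+[n∸m]≡n y≤t)) t≤N)
      before : ∀ t → 1 ≤ t → t < y → A y + t < A t + y
      before t 1≤t t<y =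
        from (high-comparison (A y) (A t) _ n s t (n ∸ s) (count-rot-high s t t≤s s≤n) (m∸n+n≡m s≤n))
          (counts (n ∸ s + t) (subst (n ∸ s + t ≤_) (m∸n+n≡m s≤n) (+-monoʳ-≤ (n ∸ s) t≤s)))
        where
        t≤s = ≤-pred t<y

    lowest⇒rotation-parking : ∀ s → s ≤ n → LowestPoint A N (suc s) → ParkingCounts n (map (rot s) xs)
    lowest⇒rotation-parking s s≤n (after , before) j j≤n with j ≤? n ∸ s
    ... | yes j≤n∸s =
      to (low-comparison (A y) (A (y + j)) _ y j (count-rot-low s j s+j≤n)) (after (y + j) (m≤m+n y j) (s≤s s+j≤n))
      where
      y = suc s
      s+j≤n : s + j ≤ n
      s+j≤n = subst (s + j ≤_) (m+[n∸m]≡n s≤n) (+-monoʳ-≤ s j≤n∸s)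
    ... | no j≰n∸s = subst (λ z → z ≤ count (inRange? z) (map (rot s) xs)) (m+[n∸m]≡n (<⇒≤ n∸s<j))
      (to (high-comparison (A y) (A t) _ n s t (n ∸ s) (count-rot-high s t t≤s s≤n) (m∸n+n≡m s≤n))
        (before t 1≤t (s≤s t≤s)))
      where
      y = suc s
      n∸s<j = ≰⇒> j≰n∸s
      t = j ∸ (n ∸ s)
      1≤t : 1 ≤ t
      1≤t = +-cancelˡ-≤ (n ∸ s) 1 t (subst₂ _≤_ (+-comm 1 (n ∸ s)) (sym (m+[n∸m]≡n (<⇒≤ n∸s<j))) n∸s<j)
      t≤s : t ≤ s
      t≤s = +-cancelˡ-≤ (n ∸ s) t s (subst₂ _≤_ (sym (m+[n∸m]≡n (<⇒≤ n∸s<j))) (sym (m∸n+n≡m s≤n)) j≤n)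

  Parking : Vec (Fin N) n → Set
  Parking a = IsParkingFunction n (Vec.map toℕ a)

  letters<N : ∀ {m} (a : Vec (Fin N) m) → All (_< N) (letters a)
  letters<N [] = []
  letters<N (x ∷ a) = toℕ<n x ∷ letters<N a

  profile : Vec (Fin N) n → ℕ → ℕ
  profile a t = count (_<? t) (letters a)

  rotate-parking⇔lowest : ∀ a s → Parking (rotate s a) ⇔ LowestPoint (profile a) N (suc (toℕ s))
  rotate-parking⇔lowest a s = mk⇔
    (λ parking → to rotated⇔ (subst (ParkingCounts n) (letters-rotate s a) (to (parking⇔counts n _) parking)))
    (λ lowest → from (parking⇔counts n _) (subst (ParkingCounts n) (sym (letters-rotate s a)) (from rotated⇔ lowest)))
    where
    open Counts (letters a) (letters<N a) (length-toList (Vec.map toℕ a))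
    rotated⇔ : ParkingCounts n (map (rot (toℕ s)) (letters a)) ⇔ LowestPoint (profile a) N (suc (toℕ s))
    rotated⇔ = mk⇔ (rotation-parking⇒lowest (toℕ s) (≤-pred (toℕ<n s))) (lowest⇒rotation-parking (toℕ s) (≤-pred (toℕ<n s)))

  lowest : ∀ a → ∃ λ s → s < N × LowestPoint (profile a) N (suc s)
  lowest a with lowestPoint-exists (profile a) N (s≤s z≤n)
  ... | suc s , _ , s<N , low = s , s<N , low

  parkingRotation : Vec (Fin N) n → Fin N
  parkingRotation a = fromℕ< (proj₁ (proj₂ (lowest a)))

  rotate-parkingRotation : ∀ a → Parking (rotate (parkingRotation a) a)
  rotate-parkingRotation a = from (rotate-parking⇔lowest a (parkingRotation a))
    (subst (λ s → LowestPoint (profile a) N (suc s)) (sym (toℕ-fromℕ< s<N)) low)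
    where
    s<N = proj₁ (proj₂ (lowest a))
    low = proj₂ (proj₂ (lowest a))

  parkingRotation-unique : ∀ a s → Parking (rotate s a) → parkingRotation a ≡ s
  parkingRotation-unique a s parking = toℕ-injective (trans (toℕ-fromℕ< s′<N) (suc-injective
    (lowestPoint-unique (profile a) N (s≤s z≤n) s′<N (s≤s z≤n) (toℕ<n s)
      low′ (to (rotate-parking⇔lowest a s) parking))))
    where
    s′<N = proj₁ (proj₂ (lowest a))
    low′ = proj₂ (proj₂ (lowest a))

module ParkingPairs (n : ℕ) where
  open Rotation n
  open InvariantPairs N

  ParkingInvariant : ℕ → Pair n → Set
  ParkingInvariant k p = Invariant n k p × Parking (proj₂ p)

  boundedFrom? : ∀ s π → Dec (BoundedFrom s π)
  boundedFrom? s [] = yes tt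
  boundedFrom? s (x ∷ π) = (x ≤? s) ×-dec boundedFrom? (suc s) π

  parking? : ∀ a → Dec (Parking a)
  parking? a =
    all? (λ i → 1 ≤? lookup (Vec.map toℕ a) i) ×-dec boundedFrom? 1 (sort (toList (Vec.map toℕ a)))

  -- Rotating a word to its parking rotation, remembering which rotation was used,
  -- is a bijection from invariant pairs to labelled parking invariant pairs.
  straighten : Pair n → Fin N × Pair n
  straighten (σ , a) = parkingRotation a , σ , rotate (parkingRotation a) a

  straighten-pres : ∀ k p → Invariant n k p → ParkingInvariant k (proj₂ (straighten p))
  straighten-pres k (σ , a) (perm , cycles , fixed) =
    (perm , cycles , map-fixed _ a σ fixed) , rotate-parkingRotation a

  straighten-inj : ∀ {p q} → straighten p ≡ straighten q → p ≡ q
  straighten-inj {σ , a} {σ′ , a′} e = cong₂ _,_ (cong (proj₁ ∘ proj₂) e) (begin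
    a                                                              ≡⟨ sym (unrotate-rotate (parkingRotation a) a) ⟩
    unrotate (parkingRotation a) (rotate (parkingRotation a) a)    ≡⟨ cong₂ (λ s b → unrotate s b)
                                                                        (cong proj₁ e) (cong (proj₂ ∘ proj₂) e) ⟩
    unrotate (parkingRotation a′) (rotate (parkingRotation a′) a′) ≡⟨ unrotate-rotate (parkingRotation a′) a′ ⟩
    a′                                                             ∎)
    where open ≡-Reasoning

  straighten-onto : ∀ k q → ParkingInvariant k (proj₂ q) → ∃ λ p → Invariant n k p × straighten p ≡ q
  straighten-onto k (s , σ , b) ((perm , cycles , fixed) , parking-b) =
    (σ , a) , (perm , cycles , map-fixed _ b σ fixed) ,
    cong₂ (λ s′ b′ → s′ , σ , b′) s-unique (trans (cong (λ s′ → rotate s′ a) s-unique) (rotate-unrotate s b))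
    where
    a = unrotate s b
    s-unique : parkingRotation a ≡ s
    s-unique = parkingRotation-unique a s (subst Parking (sym (rotate-unrotate s b)) parking-b)

  count-parking : ∀ k → Σ (Enumeration (ParkingInvariant k)) λ e → N * card e ≡ coeff k (Rising N n)
  count-parking k = parking , (begin
    N * card parking     ≡⟨ sym (proj₂ (enumerate-Fin× N parking)) ⟩
    card labelled        ≡⟨ card-cong labelled rotated (λ _ → mk⇔ (λ x → x) (λ x → x)) ⟩
    card rotated         ≡⟨ proj₂ straightened ⟩
    card invariant       ≡⟨ proj₂ (count-invariant n k) ⟩
    coeff k (Rising N n) ∎)
    where
    open ≡-Reasoning
    invariant = proj₁ (count-invariant n k)
    parking = enumerate-filter invariant (λ p → parking? (proj₂ p))
    labelled = proj₁ (enumerate-Fin× N parking)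
    straightened = enumerate-image straighten (λ _ _ → straighten-inj) (straighten-pres k) (straighten-onto k) invariant
    rotated = proj₁ straightened

  -- Reading a natural number as a letter (arbitrarily when it is too large).
  clamp : ℕ → Fin N
  clamp x with x <? N
  ... | yes x<N = fromℕ< x<N
  ... | no _ = zero

  toℕ-clamp : ∀ {x} → x < N → toℕ (clamp x) ≡ x
  toℕ-clamp {x} x<N with x <? N
  ... | yes _ = toℕ-fromℕ< _
  ... | no x≮N = ⊥-elim (x≮N x<N)

  map-toℕ-injective : ∀ {m} {a a′ : Vec (Fin N) m} → Vec.map toℕ a ≡ Vec.map toℕ a′ → a ≡ a′
  map-toℕ-injective {a = a} {a′} e = vec-ext λ i →
    toℕ-injective (trans (sym (lookup-map i toℕ a)) (trans (cong (λ v → lookup v i) e) (lookup-map i toℕ a′)))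

  parking-letters<N : ∀ a′ → IsParkingFunction n a′ → ∀ i → lookup a′ i < N
  parking-letters<N a′ parking = VecAll.lookup⁺ (VecAll.toList⁻
    (All.map (λ in-range → s≤s (proj₂ in-range))
      (parkingCounts⇒inRange (toList a′) (length-toList a′) (to (parking⇔counts n a′) parking))))

  count-counted : ∀ k (e : Enumeration (ParkingInvariant k)) → Σ (Enumeration (Counted n k)) λ e′ → card e′ ≡ card e
  count-counted k = enumerate-image forget forget-inj forget-pres forget-onto
    where
    forget : Pair n → Vec ℕ n × Vec (Fin n) n
    forget (σ , a) = Vec.map toℕ a , σ
    forget-inj : ∀ {p q} → ParkingInvariant k p → ParkingInvariant k q → forget p ≡ forget q → p ≡ q
    forget-inj _ _ e = cong₂ _,_ (cong proj₂ e) (map-toℕ-injective (cong proj₁ e))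
    forget-pres : ∀ p → ParkingInvariant k p → Counted n k (forget p)
    forget-pres (σ , a) ((perm , cycles , fixed) , parking) = parking , perm , cycles , map-fixed toℕ a σ fixed
    forget-onto : ∀ q → Counted n k q → ∃ λ p → ParkingInvariant k p × forget p ≡ q
    forget-onto (a′ , σ) (parking , perm , cycles , fixed) =
      (σ , Vec.map clamp a′) ,
      ((perm , cycles , map-fixed clamp a′ σ fixed) , subst (IsParkingFunction n) (sym unclamped) parking) ,
      cong (_, σ) unclamped
      where
      unclamped : Vec.map toℕ (Vec.map clamp a′) ≡ a′
      unclamped = vec-ext λ i → trans (lookup-map i toℕ (Vec.map clamp a′))
        (trans (cong toℕ (lookup-map i clamp a′)) (toℕ-clamp (parking-letters<N a′ parking i)))

mainTheorem9 : (n : ℕ) → 1 ≤ n → (k : ℕ) →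
    Σ (List (Vec ℕ n × Vec (Fin n) n)) λ L →
    Unique L × (∀ p → (p ∈ L) ⇔ Counted n k p) × (length L ≡ coeff k (P n))
mainTheorem9 n 1≤n k = L , unique , member , (begin
  length L           ≡⟨ #counted ⟩
  card parking       ≡⟨ *-cancelˡ-≡ (card parking) (coeff k (P n)) (suc n) N*count ⟩
  coeff k (P n)      ∎)
  where
  open ≡-Reasoning
  open ParkingPairs n
  parking = proj₁ (count-parking k)
  N*count : suc n * card parking ≡ suc n * coeff k (P n)
  N*count = trans (proj₂ (count-parking k)) (coeff-Rising-P n 1≤n k)
  counted = count-counted k parking
  L = proj₁ (proj₁ counted)
  unique = proj₁ (proj₂ (proj₁ counted))
  member = proj₂ (proj₂ (proj₁ counted))
  #counted = proj₂ counted
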